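{- Let $G$ be a graph such that $\mathrm{diam}(G) = \mathrm{diam}(\overline{G}) = 2$. If $G$ is not the cycle $C_5$, then $\mathrm{m}(G\overline{G})= 2$.
   Context: All graphs are finite, simple and undirected; $\mathrm{diam}(G)$ is the diameter of $G$. The complementary prism $G\overline{G}$ of a graph $G$ is obtained from the disjoint union of $G$ and its complement $\overline{G}$ by adding the edges of the perfect matching joining each vertex $u$ of $G$ to its copy $\overline{u}$ in $\overline{G}$. A path is monophonic if it is an induced (chordless) path. For vertices $u,v$ of a graph $H$, $J_H[u,v]$ is the set of vertices of all monophonic $u,v$-paths in $H$, and for $S\subseteq V(H)$, $J_H[S]=\bigcup_{u,v\in S}J_H[u,v]$. A set $S$ is a monophonic set of $H$ if $J_H[S]=V(H)$; the monophonic number $\mathrm{m}(H)$ is the minimum cardinality of a monophonic set of $H$. -}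

module Defs where

open import Data.Nat using (ℕ; zero; suc; _<_; _%_)
open import Data.Nat.Properties using () renaming (_≟_ to _≟ℕ_)
open import Data.Fin using (Fin; toℕ) renaming (zero to fz; suc to fs)
open import Data.Fin.Properties using (_≟_)
open import Data.Bool using (Bool; true; false; not; _∧_; _∨_)
open import Data.Bool.Properties using (∨-comm)
open import Data.Sum using (_⊎_; inj₁; inj₂)
open import Data.Product using (Σ; ∃; ∃-syntax; _×_; _,_)
open import Data.Maybe using (just)
open import Data.List using (List; length; lookup; head; last)
open import Data.List.Membership.Propositional using (_∈_)
open import Data.List.Relation.Unary.Unique.Propositional using (Unique)
open import Relation.Nullary using (¬_; does; yes; no)
open import Relation.Binary.PropositionalEquality using (_≡_; refl; sym; cong₂)
open import Function.Bundles using (_↔_; Inverse)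

record Graph (V : Set) : Set where
  field
    adj     : V → V → Bool
    adj-sym : ∀ u v → adj u v ≡ adj v u
    adj-irr : ∀ u → adj u u ≡ false
open Graph public

eqᶠ : ∀ {n} → Fin n → Fin n → Bool
eqᶠ u v = does (u ≟ v)

eqᶠ-sym : ∀ {n} (u v : Fin n) → eqᶠ u v ≡ eqᶠ v u
eqᶠ-sym u v with u ≟ v | v ≟ u
... | yes _ | yes _ = refl
... | no  _ | no  _ = refl
... | yes p | no ¬q = Data.Empty.⊥-elim (¬q (sym p))
  where import Data.Empty
... | no ¬p | yes q = Data.Empty.⊥-elim (¬p (sym q))
  where import Data.Empty

eqᶠ-refl : ∀ {n} (u : Fin n) → eqᶠ u u ≡ true
eqᶠ-refl u with u ≟ u
... | yes _ = refl
... | no ¬p = Data.Empty.⊥-elim (¬p refl)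
  where import Data.Empty

complement : ∀ {n} → Graph (Fin n) → Graph (Fin n)
complement G = record
  { adj     = λ u v → not (adj G u v) ∧ not (eqᶠ u v)
  ; adj-sym = λ u v → cong₂ (λ a b → not a ∧ not b) (adj-sym G u v) (eqᶠ-sym u v)
  ; adj-irr = irr
  }
  where
  irr : ∀ u → not (adj G u u) ∧ not (eqᶠ u u) ≡ false
  irr u rewrite eqᶠ-refl u with adj G u u
  ... | true  = refl
  ... | false = refl

-- The complementary prism G Ḡ: vertices inj₁ u (copy in G) and
-- inj₂ u (copy ū in Ḡ), plus the perfect matching u — ū.
prismAdj : ∀ {n} → Graph (Fin n) → Fin n ⊎ Fin n → Fin n ⊎ Fin n → Bool
prismAdj G (inj₁ u) (inj₁ v) = adj G u v
prismAdj G (inj₂ u) (inj₂ v) = adj (complement G) u v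
prismAdj G (inj₁ u) (inj₂ v) = eqᶠ u v
prismAdj G (inj₂ u) (inj₁ v) = eqᶠ u v

prismAdj-sym : ∀ {n} (G : Graph (Fin n)) u v → prismAdj G u v ≡ prismAdj G v u
prismAdj-sym G (inj₁ u) (inj₁ v) = adj-sym G u v
prismAdj-sym G (inj₂ u) (inj₂ v) = adj-sym (complement G) u v
prismAdj-sym G (inj₁ u) (inj₂ v) = eqᶠ-sym u v
prismAdj-sym G (inj₂ u) (inj₁ v) = eqᶠ-sym u v

prismAdj-irr : ∀ {n} (G : Graph (Fin n)) u → prismAdj G u u ≡ false
prismAdj-irr G (inj₁ u) = adj-irr G u
prismAdj-irr G (inj₂ u) = adj-irr (complement G) u

complementaryPrism : ∀ {n} → Graph (Fin n) → Graph (Fin n ⊎ Fin n)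
complementaryPrism G = record
  { adj = prismAdj G ; adj-sym = prismAdj-sym G ; adj-irr = prismAdj-irr G }

-- Reach H k u v : there is a u,v-walk with at most k edges (d(u,v) ≤ k).
Reach : ∀ {V} → Graph V → ℕ → V → V → Set
Reach H zero    u v = u ≡ v
Reach H (suc k) u v = u ≡ v ⊎ ∃[ w ] (adj H u w ≡ true × Reach H k w v)

HasDiameter : ∀ {V} → Graph V → ℕ → Set
HasDiameter {V} H d =
  (∀ (u v : V) → Reach H d u v) ×
  (∀ d' → d' < d → ∃[ u ] ∃[ v ] (¬ Reach H d' u v))

IsMonophonicPath : ∀ {V} → Graph V → V → V → List V → Set
IsMonophonicPath H u v p =
  head p ≡ just u × last p ≡ just v × Unique p ×
  (∀ (i j : Fin (length p)) →
     (adj H (lookup p i) (lookup p j) ≡ true →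
        (suc (toℕ i) ≡ toℕ j ⊎ suc (toℕ j) ≡ toℕ i)) ×
     ((suc (toℕ i) ≡ toℕ j ⊎ suc (toℕ j) ≡ toℕ i) →
        adj H (lookup p i) (lookup p j) ≡ true))

InInterval : ∀ {V} → Graph V → V → V → V → Set
InInterval {V} H u v w = ∃[ p ] (IsMonophonicPath H u v p × w ∈ p)

IsMonophonicSet : ∀ {V} → Graph V → List V → Set
IsMonophonicSet {V} H S =
  ∀ (w : V) → ∃[ u ] ∃[ v ] (u ∈ S × v ∈ S × InInterval H u v w)

MonophonicNumber : ∀ {V} → Graph V → ℕ → Set
MonophonicNumber {V} H k =
  (∃[ S ] (Unique S × length S ≡ k × IsMonophonicSet H S)) ×
  (∀ (S : List V) → Unique S → IsMonophonicSet H S → k Data.Nat.≤ length S)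

Isomorphic : ∀ {V W} → Graph V → Graph W → Set
Isomorphic {V} {W} G H =
  Σ (V ↔ W) λ f → ∀ u v → adj H (Inverse.to f u) (Inverse.to f v) ≡ adj G u v

succ5 : Fin 5 → Fin 5 → Bool
succ5 i j = does (toℕ j ≟ℕ (suc (toℕ i) % 5))

C5 : Graph (Fin 5)
C5 = record
  { adj     = λ i j → succ5 i j ∨ succ5 j i
  ; adj-sym = λ i j → ∨-comm (succ5 i j) (succ5 j i)
  ; adj-irr = irr
  }
  where
  irr : ∀ i → succ5 i i ∨ succ5 i i ≡ false
  irr fz = refl
  irr (fs fz) = refl
  irr (fs (fs fz)) = refl
  irr (fs (fs (fs fz))) = refl
  irr (fs (fs (fs (fs fz)))) = refl

{-# OPTIONS --safe #-}
-- Call an edge xy of a graph K bypassable if every neighbour t of y that is distinct from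
-- and non-adjacent to x has a common neighbour with x other than y. For a bypassable edge
-- xy, {x, ȳ} is a monophonic set of K K̄: every t and t̄ lie on one induced x,ȳ-path made
-- of x, t, t̄, ȳ, a common neighbour of x and t if x ≁ t (avoiding y if t ∼ y), and a
-- common non-neighbour of t and y if t ∼ y; these exist because K and K̄ have diameter 2.
-- The prism of Ḡ is the prism of G with its sides exchanged, so a bypassable edge of G
-- or of Ḡ gives m(G Ḡ) = 2. If no edge of G or Ḡ is bypassable, every edge xy of G lies
-- on an induced path x y w in which y is the only common neighbour of x and w, and dually
-- in Ḡ. Starting from one edge, these sole midpoints force an induced 5-cycle x u v w y,
-- and any sixth vertex would be a second common neighbour of x and w; hence G ≅ C₅.
module Submission where

open import Data.Bool using (true; false; not; _∧_)
open import Data.Bool.Properties using (∧-identityʳ; not-involutive; ¬-not) renaming (_≟_ to _≟ᵇ_)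
open import Data.Empty using (⊥; ⊥-elim)
open import Data.Fin using (Fin; toℕ) renaming (zero to fz; suc to fs)
open import Data.Fin.Properties using (_≟_; any?; all?; ¬∀⟶∃¬)
open import Data.List using (List; []; _∷_; length; lookup; head; last)
open import Data.List.Membership.Propositional using (_∈_)
open import Data.List.Membership.Propositional.Properties using (∈-lookup)
open import Data.List.Relation.Unary.All as All using (All; []; _∷_)
open import Data.List.Relation.Unary.AllPairs using ([]; _∷_)
open import Data.List.Relation.Unary.Any using (here; there)
open import Data.List.Relation.Unary.Unique.Propositional using (Unique)
open import Data.Maybe using (just)
open import Data.Nat using (ℕ; suc; _≤_; s≤s; z≤n)
open import Data.Nat.Properties using (suc-injective)
open import Data.Product using (∃-syntax; _×_; _,_; proj₁; proj₂)
open import Data.Sum using (_⊎_; inj₁; inj₂; map; swap)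
open import Data.Sum.Properties using (inj₁-injective; inj₂-injective)
open import Function using (_∘_)
open import Function.Bundles using (mk↔ₛ′)
open import Relation.Binary.PropositionalEquality
  using (_≡_; _≢_; refl; sym; trans; cong; cong₂; subst; ≢-sym; module ≡-Reasoning)
open import Relation.Nullary using (¬_; Dec; yes; no; ¬?)
open import Relation.Nullary.Decidable
  using (dec-false; toWitness; _×-dec_; _→-dec_; decidable-stable)

open import Defs

module _ {V : Set} (H : Graph V) where

  Apart : V → V → Set
  Apart u v = u ≢ v × adj H u v ≡ false

  ∼⇒≢ : ∀ {u v} → adj H u v ≡ true → u ≢ v
  ∼⇒≢ {u} u∼v refl with () ← trans (sym (adj-irr H u)) u∼v

  apart⇒≁ : ∀ {u v} → Apart u v → ¬ (adj H u v ≡ true)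
  apart⇒≁ (_ , u≁v) u∼v with () ← trans (sym u≁v) u∼v

  adj-swap : ∀ {u v b} → adj H u v ≡ b → adj H v u ≡ b
  adj-swap {u} {v} e = trans (adj-sym H v u) e

  apart-sym : ∀ {u v} → Apart u v → Apart v u
  apart-sym (u≢v , u≁v) = ≢-sym u≢v , adj-swap u≁v

  ∼-≁⇒≢ : ∀ {u v w} → adj H u w ≡ true → adj H v w ≡ false → u ≢ v
  ∼-≁⇒≢ u∼w v≁w refl with () ← trans (sym v≁w) u∼w

  reach₂-apart⇒commonNeighbour : ∀ {u v} → Reach H 2 u v → Apart u v →
    ∃[ a ] (adj H u a ≡ true × adj H a v ≡ true)
  reach₂-apart⇒commonNeighbour (inj₁ u≡v)                    (u≢v , _) = ⊥-elim (u≢v u≡v)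
  reach₂-apart⇒commonNeighbour (inj₂ (_ , u∼v , inj₁ refl))  apart     = ⊥-elim (apart⇒≁ apart u∼v)
  reach₂-apart⇒commonNeighbour (inj₂ (a , u∼a , inj₂ (_ , a∼v , refl))) _ = a , u∼a , a∼v

  data InducedPath : List V → Set where
    [_]  : ∀ v → InducedPath (v ∷ [])
    step : ∀ {v w p} → adj H v w ≡ true → All (Apart v) p →
           InducedPath (w ∷ p) → InducedPath (v ∷ w ∷ p)

  Consecutive : ∀ {m} → Fin m → Fin m → Set
  Consecutive i j = suc (toℕ i) ≡ toℕ j ⊎ suc (toℕ j) ≡ toℕ i

  AdjacentIffConsecutive : ∀ {m} → V → V → Fin m → Fin m → Set
  AdjacentIffConsecutive a b i j =
    (adj H a b ≡ true → Consecutive i j) × (Consecutive i j → adj H a b ≡ true)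

  private
    adjacentIffConsecutive-sym : ∀ {m a b} {i j : Fin m} →
      AdjacentIffConsecutive a b i j → AdjacentIffConsecutive b a j i
    adjacentIffConsecutive-sym {a = a} {b} (⇒ , ⇐) =
      (λ b∼a → swap (⇒ (trans (adj-sym H a b) b∼a))) ,
      (λ c → trans (adj-sym H b a) (⇐ (swap c)))

    adjacentIffConsecutive-suc : ∀ {m a b} {i j : Fin m} →
      AdjacentIffConsecutive a b i j → AdjacentIffConsecutive a b (fs i) (fs j)
    adjacentIffConsecutive-suc (⇒ , ⇐) =
      (λ a∼b → map (cong suc) (cong suc) (⇒ a∼b)) ,
      (λ c → ⇐ (map suc-injective suc-injective c))

    adjacentIffConsecutive-refl : ∀ m a → AdjacentIffConsecutive a a (fz {m}) fz
    adjacentIffConsecutive-refl _ a = (λ a∼a → ⊥-elim (∼⇒≢ a∼a refl)) , λ { (inj₁ ()) ; (inj₂ ()) }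

  inducedPath-unique : ∀ {p} → InducedPath p → Unique p
  inducedPath-unique [ v ]          = [] ∷ []
  inducedPath-unique (step v∼w a q) = (∼⇒≢ v∼w ∷ All.map proj₁ a) ∷ inducedPath-unique q

  private
    inducedPath-chordlessʰ : ∀ {v p} → InducedPath (v ∷ p) → ∀ (j : Fin (suc (length p))) →
      AdjacentIffConsecutive v (lookup (v ∷ p) j) fz j
    inducedPath-chordlessʰ {v} {p} _ fz = adjacentIffConsecutive-refl (length p) v
    inducedPath-chordlessʰ (step v∼w _ _) (fs fz) = (λ _ → inj₁ refl) , (λ _ → v∼w)
    inducedPath-chordlessʰ (step _ apart _) (fs (fs k)) =
      (λ v∼ → ⊥-elim (apart⇒≁ (All.lookup apart (∈-lookup k)) v∼)) , λ { (inj₁ ()) ; (inj₂ ()) }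

  inducedPath-chordless : ∀ {p} → InducedPath p → ∀ (i j : Fin (length p)) →
    AdjacentIffConsecutive (lookup p i) (lookup p j) i j
  inducedPath-chordless [ v ] fz fz = adjacentIffConsecutive-refl 0 v
  inducedPath-chordless q@(step _ _ _) fz j = inducedPath-chordlessʰ q j
  inducedPath-chordless q@(step _ _ _) (fs i) fz =
    adjacentIffConsecutive-sym (inducedPath-chordlessʰ q (fs i))
  inducedPath-chordless (step _ _ q) (fs i) (fs j) =
    adjacentIffConsecutive-suc (inducedPath-chordless q i j)

  inducedPath⇒monophonic : ∀ {p u v} → head p ≡ just u → last p ≡ just v →
    InducedPath p → IsMonophonicPath H u v p
  inducedPath⇒monophonic h l q = h , l , inducedPath-unique q , inducedPath-chordless q

  ∈-monophonicPath-self : ∀ {u w p} → IsMonophonicPath H u u p → w ∈ p → w ≡ u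
  ∈-monophonicPath-self {p = _ ∷ []}    (refl , _ , _ , _) (here w≡u) = w≡u
  ∈-monophonicPath-self {p = _ ∷ _ ∷ _} (refl , last≡u , (u∉ ∷ _) , _) _ =
    ⊥-elim (All.lookup u∉ (last-∈ _ last≡u) refl)
    where
    last-∈ : ∀ (q : List V) {z} → last q ≡ just z → z ∈ q
    last-∈ (_ ∷ [])     refl = here refl
    last-∈ (_ ∷ b ∷ q) l≡z  = there (last-∈ (b ∷ q) l≡z)

  monophonicSet-length≥2 : ∀ {w₁ w₂} → w₁ ≢ w₂ → ∀ S → IsMonophonicSet H S → 2 ≤ length S
  monophonicSet-length≥2 {w₁} _ [] mono with mono w₁
  ... | _ , _ , () , _
  monophonicSet-length≥2 {w₁} {w₂} w₁≢w₂ (s ∷ []) mono =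
    ⊥-elim (w₁≢w₂ (trans (≡s w₁) (sym (≡s w₂))))
    where
    ≡s : ∀ w → w ≡ s
    ≡s w with mono w
    ... | _ , _ , here refl , here refl , _ , path , w∈ = ∈-monophonicPath-self path w∈
  monophonicSet-length≥2 _ (_ ∷ _ ∷ _) _ = s≤s (s≤s z≤n)

record Complementary {n} (K L : Graph (Fin n)) : Set where
  constructor complementary
  field adj-complement : ∀ u v → u ≢ v → adj L u v ≡ not (adj K u v)

complement-complementary : ∀ {n} (G : Graph (Fin n)) → Complementary G (complement G)
complement-complementary G = complementary λ u v u≢v →
  trans (cong (λ b → not (adj G u v) ∧ not b) (dec-false (u ≟ v) u≢v)) (∧-identityʳ _)

module _ {n} {K L : Graph (Fin n)} (K⊥L : Complementary K L) where
  open Complementary K⊥L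

  complementary-sym : Complementary L K
  complementary-sym = complementary λ u v u≢v → begin
    adj K u v             ≡⟨ not-involutive _ ⟨
    not (not (adj K u v)) ≡⟨ cong not (adj-complement u v u≢v) ⟨
    not (adj L u v)       ∎
    where open ≡-Reasoning

  apart⇒adjᶜ : ∀ {u v} → Apart K u v → adj L u v ≡ true
  apart⇒adjᶜ {u} {v} (u≢v , u≁v) = trans (adj-complement u v u≢v) (cong not u≁v)

  adj⇒¬adjᶜ : ∀ {u v} → adj K u v ≡ true → adj L u v ≡ false
  adj⇒¬adjᶜ {u} {v} u∼v = trans (adj-complement u v (∼⇒≢ K u∼v)) (cong not u∼v)

adjᶜ⇒apart : ∀ {n} {K L : Graph (Fin n)} → Complementary K L →
  ∀ {u v} → adj L u v ≡ true → Apart K u v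
adjᶜ⇒apart {L = L} K⊥L u∼v = ∼⇒≢ L u∼v , adj⇒¬adjᶜ (complementary-sym K⊥L) u∼v

Bypass : ∀ {V} → Graph V → V → V → V → Set
Bypass K x y t = ∃[ a ] (a ≢ y × adj K x a ≡ true × adj K a t ≡ true)

Bypassable : ∀ {V} → Graph V → V → V → Set
Bypassable K x y = adj K x y ≡ true × (∀ t → adj K y t ≡ true → Apart K x t → Bypass K x y t)

record IsComplementaryPrism {n} {W : Set} (H : Graph W) (K L : Graph (Fin n)) : Set where
  field
    i j         : Fin n → W
    i-injective : ∀ {u v} → i u ≡ i v → u ≡ v
    j-injective : ∀ {u v} → j u ≡ j v → u ≡ v
    i≢j         : ∀ u v → i u ≢ j v
    i-or-j      : ∀ w → (∃[ u ] w ≡ i u) ⊎ (∃[ u ] w ≡ j u)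
    adj-ii      : ∀ u v → adj H (i u) (i v) ≡ adj K u v
    adj-jj      : ∀ u v → adj H (j u) (j v) ≡ adj L u v
    adj-ij      : ∀ u v → adj H (i u) (j v) ≡ eqᶠ u v

complementaryPrism-left : ∀ {n} (G : Graph (Fin n)) →
  IsComplementaryPrism (complementaryPrism G) G (complement G)
complementaryPrism-left G = record
  { i = inj₁ ; j = inj₂ ; i-injective = inj₁-injective ; j-injective = inj₂-injective
  ; i≢j = λ _ _ () ; i-or-j = λ { (inj₁ u) → inj₁ (u , refl) ; (inj₂ u) → inj₂ (u , refl) }
  ; adj-ii = λ _ _ → refl ; adj-jj = λ _ _ → refl ; adj-ij = λ _ _ → refl }

complementaryPrism-right : ∀ {n} (G : Graph (Fin n)) →
  IsComplementaryPrism (complementaryPrism G) (complement G) G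
complementaryPrism-right G = record
  { i = inj₂ ; j = inj₁ ; i-injective = inj₂-injective ; j-injective = inj₁-injective
  ; i≢j = λ _ _ () ; i-or-j = λ { (inj₁ u) → inj₂ (u , refl) ; (inj₂ u) → inj₁ (u , refl) }
  ; adj-ii = λ _ _ → refl ; adj-jj = λ _ _ → refl ; adj-ij = λ _ _ → refl }

module _ {n} {W : Set} {H : Graph W} {K L : Graph (Fin n)}
  (prism : IsComplementaryPrism H K L) (K⊥L : Complementary K L)
  (reachK : ∀ u v → Reach K 2 u v) (reachL : ∀ u v → Reach L 2 u v)
  {x y : Fin n} (x⇝y : Bypassable K x y)
  where
  open IsComplementaryPrism prism

  private
    x∼y : adj K x y ≡ true
    x∼y = proj₁ x⇝y

    ii : ∀ {u v} → adj K u v ≡ true → adj H (i u) (i v) ≡ true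
    ii {u} {v} u∼v = trans (adj-ii u v) u∼v

    jj : ∀ {u v} → Apart K u v → adj H (j u) (j v) ≡ true
    jj {u} {v} u∥v = trans (adj-jj u v) (apart⇒adjᶜ K⊥L u∥v)

    ij : ∀ {u} → adj H (i u) (j u) ≡ true
    ij {u} = trans (adj-ij u u) (eqᶠ-refl u)

    apart-ii : ∀ {u v} → Apart K u v → Apart H (i u) (i v)
    apart-ii {u} {v} (u≢v , u≁v) = u≢v ∘ i-injective , trans (adj-ii u v) u≁v

    apart-jj : ∀ {u v} → adj K u v ≡ true → Apart H (j u) (j v)
    apart-jj {u} {v} u∼v = ∼⇒≢ K u∼v ∘ j-injective , trans (adj-jj u v) (adj⇒¬adjᶜ K⊥L u∼v)

    apart-ij : ∀ {u v} → u ≢ v → Apart H (i u) (j v)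
    apart-ij {u} {v} u≢v = i≢j u v , trans (adj-ij u v) (dec-false (u ≟ v) u≢v)

    commonNonNeighbour : ∀ {u v} → adj K u v ≡ true → ∃[ z ] (Apart K u z × Apart K z v)
    commonNonNeighbour {u} {v} u∼v
      with reach₂-apart⇒commonNeighbour L (reachL u v) (∼⇒≢ K u∼v , adj⇒¬adjᶜ K⊥L u∼v)
    ... | z , u∼ᶜz , z∼ᶜv = z , adjᶜ⇒apart K⊥L u∼ᶜz , adjᶜ⇒apart K⊥L z∼ᶜv

    Through : Fin n → Set
    Through t = ∃[ p ] (IsMonophonicPath H (i x) (j y) p × i t ∈ p × j t ∈ p)

    monophonic : ∀ {p} → head p ≡ just (i x) → last p ≡ just (j y) →
      InducedPath H p → IsMonophonicPath H (i x) (j y) p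
    monophonic = inducedPath⇒monophonic H

    x≢y : x ≢ y
    x≢y = ∼⇒≢ K x∼y

    through-y : Through y
    through-y = _ , monophonic refl refl (step (ii x∼y) (apart-ij x≢y ∷ []) (step ij [] [ j y ]))
                  , there (here refl) , there (there (here refl))

    through-x : Through x
    through-x with commonNonNeighbour x∼y
    ... | z , x∥z , z∥y = _ , monophonic refl refl
            (step ij (apart-ij (proj₁ x∥z) ∷ apart-ij x≢y ∷ [])
            (step (jj x∥z) (apart-jj x∼y ∷ [])
            (step (jj z∥y) [] [ j y ])))
          , here refl , there (here refl)

    through-x∼t∼y : ∀ {t} → t ≢ x → adj K x t ≡ true → adj K t y ≡ true → Through t
    through-x∼t∼y {t} t≢x x∼t t∼y with commonNonNeighbour t∼y
    ... | z , t∥z , z∥y = _ , monophonic refl refl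
            (step (ii x∼t) (apart-ij (≢-sym t≢x) ∷ apart-ij x≢z ∷ apart-ij x≢y ∷ [])
            (step ij (apart-ij (proj₁ t∥z) ∷ apart-ij (∼⇒≢ K t∼y) ∷ [])
            (step (jj t∥z) (apart-jj t∼y ∷ [])
            (step (jj z∥y) [] [ j y ]))))
          , there (here refl) , there (there (here refl))
      where
      x≢z : x ≢ z
      x≢z = ∼-≁⇒≢ K x∼y (proj₂ z∥y)

    through-x∼t≁y : ∀ {t} → t ≢ x → t ≢ y → adj K x t ≡ true → adj K t y ≡ false → Through t
    through-x∼t≁y {t} t≢x t≢y x∼t t≁y = _ , monophonic refl refl
        (step (ii x∼t) (apart-ij (≢-sym t≢x) ∷ apart-ij x≢y ∷ [])
        (step ij (apart-ij t≢y ∷ [])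
        (step (jj (t≢y , t≁y)) [] [ j y ])))
      , there (here refl) , there (there (here refl))

    through-x≁t≁y : ∀ {t} → t ≢ x → t ≢ y → adj K x t ≡ false → adj K t y ≡ false → Through t
    through-x≁t≁y {t} t≢x t≢y x≁t t≁y
      with reach₂-apart⇒commonNeighbour K (reachK x t) (≢-sym t≢x , x≁t)
    ... | a , x∼a , a∼t = _ , monophonic refl refl
            (step (ii x∼a) (apart-ii (≢-sym t≢x , x≁t) ∷ apart-ij (≢-sym t≢x) ∷ apart-ij x≢y ∷ [])
            (step (ii a∼t) (apart-ij (∼⇒≢ K a∼t) ∷ apart-ij (∼-≁⇒≢ K a∼t (adj-swap K t≁y)) ∷ [])
            (step ij (apart-ij t≢y ∷ [])
            (step (jj (t≢y , t≁y)) [] [ j y ]))))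
          , there (there (here refl)) , there (there (there (here refl)))

    through-x≁t∼y : ∀ {t} → t ≢ x → adj K x t ≡ false → adj K t y ≡ true → Through t
    through-x≁t∼y {t} t≢x x≁t t∼y
      with proj₂ x⇝y t (adj-swap K t∼y) (≢-sym t≢x , x≁t) | commonNonNeighbour t∼y
    ... | a , a≢y , x∼a , a∼t | z , t∥z , z∥y = _ , monophonic refl refl
            (step (ii x∼a) (apart-ii (≢-sym t≢x , x≁t) ∷ apart-ij (≢-sym t≢x) ∷ apart-ij x≢z
                            ∷ apart-ij x≢y ∷ [])
            (step (ii a∼t) (apart-ij (∼⇒≢ K a∼t) ∷ apart-ij a≢z ∷ apart-ij a≢y ∷ [])
            (step ij (apart-ij (proj₁ t∥z) ∷ apart-ij (∼⇒≢ K t∼y) ∷ [])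
            (step (jj t∥z) (apart-jj t∼y ∷ [])
            (step (jj z∥y) [] [ j y ])))))
          , there (there (here refl)) , there (there (there (here refl)))
      where
      x≢z : x ≢ z
      x≢z = ∼-≁⇒≢ K x∼y (proj₂ z∥y)
      a≢z : a ≢ z
      a≢z = ∼-≁⇒≢ K a∼t (proj₂ (apart-sym K t∥z))

    through : ∀ t → Through t
    through t with t ≟ x | t ≟ y
    ... | yes refl | _        = through-x
    ... | no _     | yes refl = through-y
    ... | no t≢x   | no t≢y   with adj K x t in x?t | adj K t y in t?y
    ... | true  | true  = through-x∼t∼y t≢x x?t t?y
    ... | true  | false = through-x∼t≁y t≢x t≢y x?t t?y
    ... | false | false = through-x≁t≁y t≢x t≢y x?t t?y
    ... | false | true  = through-x≁t∼y t≢x x?t t?y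

  bypassable⇒monophonicPair : ∃[ S ] (Unique S × length S ≡ 2 × IsMonophonicSet H S)
  bypassable⇒monophonicPair = i x ∷ j y ∷ [] , (i≢j x y ∷ []) ∷ [] ∷ [] , refl , covered
    where
    covered : IsMonophonicSet H (i x ∷ j y ∷ [])
    covered w with i-or-j w
    ... | inj₁ (t , refl) = let p , path , it∈ , _ = through t in
                            i x , j y , here refl , there (here refl) , p , path , it∈
    ... | inj₂ (t , refl) = let p , path , _ , jt∈ = through t in
                            i x , j y , here refl , there (here refl) , p , path , jt∈

record SoleMidpoint {V : Set} (K : Graph V) (x y t : V) : Set where
  field
    x∼y  : adj K x y ≡ true
    y∼t  : adj K y t ≡ true
    x∥t  : Apart K x t
    only : ∀ a → adj K x a ≡ true → adj K a t ≡ true → a ≡ y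

record SoleCoMidpoint {V : Set} (K : Graph V) (p q c : V) : Set where
  field
    p∥q  : Apart K p q
    q∥c  : Apart K q c
    p∼c  : adj K p c ≡ true
    only : ∀ a → Apart K p a → Apart K a c → a ≡ q

soleMidpointᶜ⇒soleCoMidpoint : ∀ {n} {K L : Graph (Fin n)} → Complementary K L →
  ∀ {p q c} → SoleMidpoint L p q c → SoleCoMidpoint K p q c
soleMidpointᶜ⇒soleCoMidpoint K⊥L m = record
  { p∥q = adjᶜ⇒apart K⊥L x∼y ; q∥c = adjᶜ⇒apart K⊥L y∼t
  ; p∼c = apart⇒adjᶜ (complementary-sym K⊥L) x∥t
  ; only = λ a p∥a a∥c → only a (apart⇒adjᶜ K⊥L p∥a) (apart⇒adjᶜ K⊥L a∥c) }
  where open SoleMidpoint m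

module _ {n} (K : Graph (Fin n)) where

  private
    negated-implication : ∀ {A B : Set} → Dec A → ¬ (A → B) → A × ¬ B
    negated-implication (yes a) ¬[A→B] = a , λ b → ¬[A→B] (λ _ → b)
    negated-implication (no ¬a) ¬[A→B] = ⊥-elim (¬[A→B] (λ a → ⊥-elim (¬a a)))

    apart? : ∀ u v → Dec (Apart K u v)
    apart? u v = ¬? (u ≟ v) ×-dec (adj K u v ≟ᵇ false)

    bypass? : ∀ x y t → Dec (Bypass K x y t)
    bypass? x y t = any? λ a → ¬? (a ≟ y) ×-dec (adj K x a ≟ᵇ true) ×-dec (adj K a t ≟ᵇ true)

    bypassAt? : ∀ x y t → Dec (adj K y t ≡ true → Apart K x t → Bypass K x y t)
    bypassAt? x y t = (adj K y t ≟ᵇ true) →-dec apart? x t →-dec bypass? x y t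

    bypassable? : ∀ x y → Dec (Bypassable K x y)
    bypassable? x y = (adj K x y ≟ᵇ true) ×-dec all? (bypassAt? x y)

  bypassableEdge? : Dec (∃[ x ] ∃[ y ] Bypassable K x y)
  bypassableEdge? = any? λ x → any? (bypassable? x)

  ¬bypassable⇒soleMidpoint : ∀ {x y} → adj K x y ≡ true → ¬ Bypassable K x y →
    ∃[ t ] SoleMidpoint K x y t
  ¬bypassable⇒soleMidpoint {x} {y} x∼y ¬bypassable
    with ¬∀⟶∃¬ n _ (bypassAt? x y) (λ bypass → ¬bypassable (x∼y , bypass))
  ... | t , ¬bypassAt with negated-implication (adj K y t ≟ᵇ true) ¬bypassAt
  ... | y∼t , ¬bypassAt′ with negated-implication (apart? x t) ¬bypassAt′
  ... | x∥t , ¬bypass = t , record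
    { x∼y = x∼y ; y∼t = y∼t ; x∥t = x∥t
    ; only = λ a x∼a a∼t → decidable-stable (a ≟ y) λ a≢y → ¬bypass (a , a≢y , x∼a , a∼t) }

module _ {n} (K : Graph (Fin n)) where

  soleMidpoint-sym : ∀ {x y t} → SoleMidpoint K x y t → SoleMidpoint K t y x
  soleMidpoint-sym m = record
    { x∼y = adj-swap K y∼t ; y∼t = adj-swap K x∼y ; x∥t = apart-sym K x∥t
    ; only = λ a t∼a a∼x → only a (adj-swap K a∼x) (adj-swap K t∼a) }
    where open SoleMidpoint m

  neighbour-adj-coMidpoint-end : ∀ {x y w v a} → SoleMidpoint K x y w → SoleCoMidpoint K w x v →
    adj K x a ≡ true → a ≢ y → adj K v a ≡ true
  neighbour-adj-coMidpoint-end {w = w} {v} {a} xyw wxv x∼a a≢y = ¬-not v≁a-impossible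
    where
    module xyw = SoleMidpoint xyw
    module wxv = SoleCoMidpoint wxv
    v≁a-impossible : adj K v a ≡ false → ⊥
    v≁a-impossible v≁a with adj K a w in a?w
    ... | true  = a≢y (xyw.only a x∼a a?w)
    ... | false = ∼⇒≢ K x∼a (sym (wxv.only a (w≢a , adj-swap K a?w) (a≢v , adj-swap K v≁a)))
      where
      w≢a : w ≢ a
      w≢a = ≢-sym (∼-≁⇒≢ K (adj-swap K x∼a) (adj-swap K (proj₂ xyw.x∥t)))
      a≢v : a ≢ v
      a≢v = ∼-≁⇒≢ K (adj-swap K x∼a) (adj-swap K (proj₂ wxv.q∥c))

  soleMidpoint-end-forced : ∀ {u v w y} → ∃[ t ] SoleMidpoint K v w t →
    (∀ {a} → adj K w a ≡ true → a ≢ y → adj K u a ≡ true) →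
    adj K u v ≡ true → u ≢ w → SoleMidpoint K v w y
  soleMidpoint-end-forced {u} {v} {w} {y} (t , vwt) w∼⇒u∼ u∼v u≢w =
    subst (SoleMidpoint K v w) t≡y vwt
    where
    open SoleMidpoint vwt
    t≡y : t ≡ y
    t≡y = decidable-stable (t ≟ y) λ t≢y → u≢w (only u (adj-swap K u∼v) (w∼⇒u∼ y∼t t≢y))

  soleCoMidpoint-end-forced : ∀ {p q r s} → ∃[ c ] SoleCoMidpoint K p q c → SoleMidpoint K r s p →
    adj K q r ≡ true → Apart K p r → SoleCoMidpoint K p q s
  soleCoMidpoint-end-forced {p} {q} {r} (c , pqc) rsp q∼r p∥r =
    subst (SoleCoMidpoint K p q) (rsp.only c r∼c (adj-swap K pqc.p∼c)) pqc
    where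
    module pqc = SoleCoMidpoint pqc
    module rsp = SoleMidpoint rsp
    r∼c : adj K r c ≡ true
    r∼c = ¬-not λ r≁c →
      ∼⇒≢ K q∼r (sym (pqc.only r p∥r (∼-≁⇒≢ K (adj-swap K q∼r) (adj-swap K (proj₂ pqc.q∥c)) , r≁c)))

TwinFree : ∀ {W} → Graph W → Set
TwinFree {W} H = ∀ (k l : W) → (∀ m → adj H k m ≡ adj H l m) → k ≡ l

C5-twinFree : TwinFree C5
C5-twinFree = toWitness {a? = all? λ k → all? λ l →
                                all? (λ m → adj C5 k m ≟ᵇ adj C5 l m) →-dec (k ≟ l)} _

adjacencyPreservingSurjection⇒isomorphic : ∀ {V W : Set} {G : Graph V} {H : Graph W} → TwinFree H →
  (c : W → V) → (∀ v → ∃[ k ] c k ≡ v) → (∀ k l → adj G (c k) (c l) ≡ adj H k l) →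
  Isomorphic G H
adjacencyPreservingSurjection⇒isomorphic {V} {W} {G} {H} twinFree c onto preserves =
  mk↔ₛ′ c⁻¹ c c⁻¹∘c c∘c⁻¹ ,
  λ u v → trans (sym (preserves (c⁻¹ u) (c⁻¹ v))) (cong₂ (adj G) (c∘c⁻¹ u) (c∘c⁻¹ v))
  where
  c⁻¹ : V → W
  c⁻¹ v = proj₁ (onto v)
  c∘c⁻¹ : ∀ v → c (c⁻¹ v) ≡ v
  c∘c⁻¹ v = proj₂ (onto v)
  c-injective : ∀ {k l} → c k ≡ c l → k ≡ l
  c-injective {k} {l} ck≡cl = twinFree k l λ m → begin
    adj H k m         ≡⟨ preserves k m ⟨
    adj G (c k) (c m) ≡⟨ cong (λ z → adj G z (c m)) ck≡cl ⟩
    adj G (c l) (c m) ≡⟨ preserves l m ⟩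
    adj H l m         ∎
    where open ≡-Reasoning
  c⁻¹∘c : ∀ k → c⁻¹ (c k) ≡ k
  c⁻¹∘c k = c-injective (c∘c⁻¹ (c k))

module _ {n} (K : Graph (Fin n))
  (soleMidpoint : ∀ {x y} → adj K x y ≡ true → ∃[ t ] SoleMidpoint K x y t)
  (soleCoMidpoint : ∀ {p q} → Apart K p q → ∃[ c ] SoleCoMidpoint K p q c)
  {x y : Fin n} (x∼y : adj K x y ≡ true)
  where

  private
    w : Fin n
    w = proj₁ (soleMidpoint x∼y)
    xyw : SoleMidpoint K x y w
    xyw = proj₂ (soleMidpoint x∼y)
    module xyw = SoleMidpoint xyw

    u : Fin n
    u = proj₁ (soleCoMidpoint xyw.x∥t)
    xwu : SoleCoMidpoint K x w u
    xwu = proj₂ (soleCoMidpoint xyw.x∥t)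
    module xwu = SoleCoMidpoint xwu

    v : Fin n
    v = proj₁ (soleCoMidpoint (apart-sym K xyw.x∥t))
    wxv : SoleCoMidpoint K w x v
    wxv = proj₂ (soleCoMidpoint (apart-sym K xyw.x∥t))
    module wxv = SoleCoMidpoint wxv

    u≢y : u ≢ y
    u≢y = ≢-sym (∼-≁⇒≢ K xyw.y∼t (adj-swap K (proj₂ xwu.q∥c)))

    u∼v : adj K u v ≡ true
    u∼v = adj-swap K (neighbour-adj-coMidpoint-end K xyw wxv xwu.p∼c u≢y)

    vwy : SoleMidpoint K v w y
    vwy = soleMidpoint-end-forced K (soleMidpoint (adj-swap K wxv.p∼c))
            (neighbour-adj-coMidpoint-end K (soleMidpoint-sym K xyw) xwu)
            u∼v (≢-sym (proj₁ xwu.q∥c))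
    module vwy = SoleMidpoint vwy

    uxy : SoleMidpoint K u x y
    uxy = soleMidpoint-end-forced K (soleMidpoint (adj-swap K xwu.p∼c))
            (neighbour-adj-coMidpoint-end K xyw wxv)
            (adj-swap K u∼v) (≢-sym (proj₁ wxv.q∥c))
    module uxy = SoleMidpoint uxy

    yvx : SoleCoMidpoint K y v x
    yvx = soleCoMidpoint-end-forced K (soleCoMidpoint (apart-sym K vwy.x∥t))
            uxy (adj-swap K u∼v) (apart-sym K uxy.x∥t)
    module yvx = SoleCoMidpoint yvx

    wuy : SoleCoMidpoint K w u y
    wuy = soleCoMidpoint-end-forced K (soleCoMidpoint xwu.q∥c)
            xyw (adj-swap K xwu.p∼c) (apart-sym K xyw.x∥t)
    module wuy = SoleCoMidpoint wuy

    adjacent-to-x-and-w : ∀ {z} → z ≢ x → z ≢ u → z ≢ v → z ≢ w → z ≢ y →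
      adj K x z ≡ true × adj K z w ≡ true
    adjacent-to-x-and-w {z} z≢x z≢u z≢v z≢w z≢y with adj K y z in y?z
    ... | true  = x∼z , z∼w
      where
      v≁z : adj K v z ≡ false
      v≁z = ¬-not λ v∼z → z≢w (vwy.only z v∼z (adj-swap K y?z))
      u≁z : adj K u z ≡ false
      u≁z = ¬-not λ u∼z → z≢x (uxy.only z u∼z (adj-swap K y?z))
      x∼z : adj K x z ≡ true
      x∼z = ¬-not λ x≁z → z≢w (xwu.only z (≢-sym z≢x , x≁z) (z≢u , adj-swap K u≁z))
      z∼w : adj K z w ≡ true
      z∼w = ¬-not λ z≁w → z≢x (wxv.only z (≢-sym z≢w , adj-swap K z≁w) (z≢v , adj-swap K v≁z))
    ... | false = x∼z , z∼w
      where
      x∼z : adj K x z ≡ true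
      x∼z = ¬-not λ x≁z → z≢v (yvx.only z (≢-sym z≢y , y?z) (z≢x , adj-swap K x≁z))
      z∼w : adj K z w ≡ true
      z∼w = ¬-not λ z≁w → z≢u (wuy.only z (≢-sym z≢w , adj-swap K z≁w) (z≢y , adj-swap K y?z))

    cycle : Fin 5 → Fin n
    cycle fz                     = x
    cycle (fs fz)                = u
    cycle (fs (fs fz))           = v
    cycle (fs (fs (fs fz)))      = w
    cycle (fs (fs (fs (fs fz)))) = y

    cycle-onto : ∀ z → ∃[ k ] cycle k ≡ z
    cycle-onto z with z ≟ x | z ≟ u | z ≟ v | z ≟ w
    ... | yes z≡x | _       | _       | _       = fz , sym z≡x
    ... | no _    | yes z≡u | _       | _       = fs fz , sym z≡u
    ... | no _    | no _    | yes z≡v | _       = fs (fs fz) , sym z≡v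
    ... | no _    | no _    | no _    | yes z≡w = fs (fs (fs fz)) , sym z≡w
    ... | no z≢x  | no z≢u  | no z≢v  | no z≢w  = fs (fs (fs (fs fz))) , z-is-y
      where
      z-is-y : y ≡ z
      z-is-y = sym (decidable-stable (z ≟ y) λ z≢y →
        let x∼z , z∼w = adjacent-to-x-and-w z≢x z≢u z≢v z≢w z≢y in z≢y (xyw.only z x∼z z∼w))

    x∼u : adj K x u ≡ true
    x∼u = xwu.p∼c
    v∼w : adj K v w ≡ true
    v∼w = adj-swap K wxv.p∼c
    w∼y : adj K w y ≡ true
    w∼y = adj-swap K xyw.y∼t
    x≁v : adj K x v ≡ false
    x≁v = proj₂ wxv.q∥c
    x≁w : adj K x w ≡ false
    x≁w = proj₂ xyw.x∥t
    u≁w : adj K u w ≡ false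
    u≁w = adj-swap K (proj₂ xwu.q∥c)
    u≁y : adj K u y ≡ false
    u≁y = proj₂ uxy.x∥t
    v≁y : adj K v y ≡ false
    v≁y = proj₂ vwy.x∥t

    preserves : ∀ k l → adj K (cycle k) (cycle l) ≡ adj C5 k l
    preserves fz fz                                         = adj-irr K x
    preserves fz (fs fz)                                    = x∼u
    preserves fz (fs (fs fz))                               = x≁v
    preserves fz (fs (fs (fs fz)))                          = x≁w
    preserves fz (fs (fs (fs (fs fz))))                     = x∼y
    preserves (fs fz) fz                                    = adj-swap K x∼u
    preserves (fs fz) (fs fz)                               = adj-irr K u
    preserves (fs fz) (fs (fs fz))                          = u∼v
    preserves (fs fz) (fs (fs (fs fz)))                     = u≁w
    preserves (fs fz) (fs (fs (fs (fs fz))))                = u≁y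
    preserves (fs (fs fz)) fz                               = adj-swap K x≁v
    preserves (fs (fs fz)) (fs fz)                          = adj-swap K u∼v
    preserves (fs (fs fz)) (fs (fs fz))                     = adj-irr K v
    preserves (fs (fs fz)) (fs (fs (fs fz)))                = v∼w
    preserves (fs (fs fz)) (fs (fs (fs (fs fz))))           = v≁y
    preserves (fs (fs (fs fz))) fz                          = adj-swap K x≁w
    preserves (fs (fs (fs fz))) (fs fz)                     = adj-swap K u≁w
    preserves (fs (fs (fs fz))) (fs (fs fz))                = adj-swap K v∼w
    preserves (fs (fs (fs fz))) (fs (fs (fs fz)))           = adj-irr K w
    preserves (fs (fs (fs fz))) (fs (fs (fs (fs fz))))      = w∼y
    preserves (fs (fs (fs (fs fz)))) fz                     = adj-swap K x∼y
    preserves (fs (fs (fs (fs fz)))) (fs fz)                = adj-swap K u≁y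
    preserves (fs (fs (fs (fs fz)))) (fs (fs fz))           = adj-swap K v≁y
    preserves (fs (fs (fs (fs fz)))) (fs (fs (fs fz)))      = adj-swap K w∼y
    preserves (fs (fs (fs (fs fz)))) (fs (fs (fs (fs fz)))) = adj-irr K y

  soleMidpoints⇒isomorphic-C5 : Isomorphic K C5
  soleMidpoints⇒isomorphic-C5 =
    adjacencyPreservingSurjection⇒isomorphic {G = K} {H = C5} C5-twinFree cycle cycle-onto preserves

diameter2⇒apartPair : ∀ {V} {K : Graph V} → HasDiameter K 2 → ∃[ u ] ∃[ v ] Apart K u v
diameter2⇒apartPair (_ , far) with far 1 (s≤s (s≤s z≤n))
... | u , v , ¬reach₁ = u , v , ¬reach₁ ∘ inj₁ , ¬-not λ u∼v → ¬reach₁ (inj₂ (v , u∼v , refl))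

diameter2⇒edge : ∀ {V} {K : Graph V} → HasDiameter K 2 → ∃[ x ] ∃[ y ] adj K x y ≡ true
diameter2⇒edge {K = K} d with diameter2⇒apartPair d
... | u , v , u∥v with reach₂-apart⇒commonNeighbour K (proj₁ d u v) u∥v
... | a , u∼a , _ = u , a , u∼a

noBypassableEdge⇒isomorphic-C5 : ∀ {n} {K L : Graph (Fin n)} → Complementary K L →
  ¬ (∃[ x ] ∃[ y ] Bypassable K x y) → ¬ (∃[ x ] ∃[ y ] Bypassable L x y) →
  ∀ {x y} → adj K x y ≡ true → Isomorphic K C5
noBypassableEdge⇒isomorphic-C5 {K = K} {L} K⊥L ¬bpK ¬bpL =
  soleMidpoints⇒isomorphic-C5 K midpoint coMidpoint
  where
  midpoint : ∀ {x y} → adj K x y ≡ true → ∃[ t ] SoleMidpoint K x y t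
  midpoint x∼y = ¬bypassable⇒soleMidpoint K x∼y λ bp → ¬bpK (_ , _ , bp)
  coMidpoint : ∀ {p q} → Apart K p q → ∃[ c ] SoleCoMidpoint K p q c
  coMidpoint p∥q with ¬bypassable⇒soleMidpoint L (apart⇒adjᶜ K⊥L p∥q) (λ bp → ¬bpL (_ , _ , bp))
  ... | c , m = c , soleMidpointᶜ⇒soleCoMidpoint K⊥L m

lemma4p5 : ∀ (n : ℕ) (G : Graph (Fin n)) →
    HasDiameter G 2 → HasDiameter (complement G) 2 →
    ¬ Isomorphic G C5 →
    MonophonicNumber (complementaryPrism G) 2
lemma4p5 n G dG dGc notC5 with diameter2⇒edge dG
... | x , _ , x∼y =
  pair , λ S _ → monophonicSet-length≥2 (complementaryPrism G) {inj₁ x} {inj₂ x} (λ ()) S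
  where
  G⊥Ḡ : Complementary G (complement G)
  G⊥Ḡ = complement-complementary G
  pair : ∃[ S ] (Unique S × length S ≡ 2 × IsMonophonicSet (complementaryPrism G) S)
  pair with bypassableEdge? G | bypassableEdge? (complement G)
  ... | yes (_ , _ , bp) | _ =
    bypassable⇒monophonicPair (complementaryPrism-left G) G⊥Ḡ (proj₁ dG) (proj₁ dGc) bp
  ... | no _ | yes (_ , _ , bp) =
    bypassable⇒monophonicPair (complementaryPrism-right G) (complementary-sym G⊥Ḡ)
      (proj₁ dGc) (proj₁ dG) bp
  ... | no ¬bpG | no ¬bpḠ = ⊥-elim (notC5 (noBypassableEdge⇒isomorphic-C5 G⊥Ḡ ¬bpG ¬bpḠ x∼y))
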